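{- The minimal DFA solving the promise problem $A^{k}=(A_{yes}^{k},A_{no}^{k})$ exactly has $2^{k+1}$ states.
   Context: Let $k$ be a positive integer and let $A_{yes}^{k}=\{a^{i2^{k}} \mid i \text{ is a nonnegative even integer}\}$ and $A_{no}^{k}=\{a^{i2^{k}} \mid i \text{ is a positive odd integer}\}$ be unary languages over $\Sigma=\{a\}$. A promise problem $(A_{yes},A_{no})$ is solved exactly by a machine if every string in $A_{yes}$ is accepted and every string in $A_{no}$ is rejected. A DFA here is a realtime deterministic finite automaton reading the input $\text{¢}w\$$ (¢ and $\$$ being the left- and right-end markers), moving its head one square right each step and stopping after reading $\$$. -}

module Defs where

open import Data.Nat using (ℕ; zero; suc; _+_; _*_; _^_)
open import Data.Fin using (Fin)
open import Data.Bool using (Bool; true; false)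
open import Data.List using (List; []; _∷_; replicate; foldl; _++_)
open import Relation.Binary.PropositionalEquality using (_≡_)
open import Data.Product using (_×_)

data TapeSym : Set where
  cent   : TapeSym
  a      : TapeSym
  dollar : TapeSym

record DFA (n : ℕ) : Set where
  field
    start  : Fin n
    δ      : Fin n → TapeSym → Fin n
    accept : Fin n → Bool

open DFA public

aWord : ℕ → List TapeSym
aWord m = replicate m a

tape : List TapeSym → List TapeSym
tape w = cent ∷ (w ++ (dollar ∷ []))

run : ∀ {n} → DFA n → Fin n → List TapeSym → Fin n
run M q xs = foldl (δ M) q xs

accepts : ∀ {n} → DFA n → List TapeSym → Bool
accepts M w = accept M (run M (start M) (tape w))

-- A^k_yes = { a^(i 2^k) | i even, i ≥ 0 },  A^k_no = { a^(i 2^k) | i odd, i > 0 }.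
-- M solves (A^k_yes, A^k_no) exactly.
SolvesExactly : ∀ {n} → ℕ → DFA n → Set
SolvesExactly {n} k M =
  (∀ j → accepts M (aWord ((2 * j) * 2 ^ k)) ≡ true)  ×
  (∀ j → accepts M (aWord ((1 + 2 * j) * 2 ^ k)) ≡ false)

-- Reading a^m drives the DFA along the orbit of one state under the letter a, so by
-- pigeonhole its verdict on a^m is periodic in m from some point on, with a period
-- d ≤ n. If d were odd, adding 2^k·d letters to an even multiple of 2^k would land
-- on an odd multiple without changing the verdict; if d = 2e, the verdict on a^(2m)
-- solves the problem for k − 1 with period e. Hence 2^(k+1) ∣ d. Conversely a counter
-- modulo 2^(k+1) solves the problem with exactly that many states.
module Submission where

open import Defs
open import Data.Nat using (ℕ; suc; _^_; _≤_)
open import Data.Product using (Σ; _×_; _,_; ∃₂)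

open import Data.Nat.Base using (zero; _+_; _*_; _∸_; _<_; s≤s; _≡ᵇ_; NonZero; >-nonZero; >-nonZero⁻¹)
open import Data.Nat.Properties
open import Data.Nat.DivMod
open import Data.Nat.Divisibility using (_∣_; ∣⇒≤; m∣m*n; *-monoʳ-∣)
open import Data.Nat.GeneralisedArithmetic using (iterate)
open import Data.Nat.Tactic.RingSolver using (solve-∀)
open import Data.Fin using (Fin; toℕ)
open import Data.Fin.Properties using (pigeonhole; toℕ<n; toℕ≤pred[n]; toℕ-fromℕ<)
open import Data.Bool using (Bool; true; false)
open import Data.List using (_∷_; [])
open import Data.List.Properties using (foldl-++)
open import Data.Empty using (⊥-elim)
open import Relation.Nullary using (¬_)
open import Relation.Binary.PropositionalEquality
  using (_≡_; refl; sym; trans; cong; subst; module ≡-Reasoning)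

private
  variable
    A : Set

PeriodicFrom : ℕ → ℕ → (ℕ → A) → Set
PeriodicFrom i d h = ∀ m → i ≤ m → h (m + d) ≡ h m

Solves : ℕ → (ℕ → Bool) → Set
Solves k h = (∀ j → h ((2 * j) * 2 ^ k) ≡ true) × (∀ j → h ((1 + 2 * j) * 2 ^ k) ≡ false)

data ParityView : ℕ → Set where
  even : ∀ e → ParityView (2 * e)
  odd  : ∀ e → ParityView (1 + 2 * e)

parityView : ∀ d → ParityView d
parityView zero = even 0
parityView (suc d) with parityView d
... | even e = odd e
... | odd e  = subst ParityView (cong suc (+-suc e (e + 0))) (even (suc e))

periodicFrom-* : ∀ {i d} {h : ℕ → A} → PeriodicFrom i d h → ∀ c → PeriodicFrom i (c * d) h
periodicFrom-* {h = h} per zero m i≤m = cong h (+-identityʳ m)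
periodicFrom-* {i = i} {d} {h} per (suc c) m i≤m = begin
  h (m + (d + c * d)) ≡⟨ cong h (+-assoc m d (c * d)) ⟨
  h (m + d + c * d)   ≡⟨ periodicFrom-* per c (m + d) (≤-trans i≤m (m≤m+n m d)) ⟩
  h (m + d)           ≡⟨ per m i≤m ⟩
  h m                 ∎
  where open ≡-Reasoning

periodicFrom-double : ∀ {i e} {h : ℕ → A} → PeriodicFrom i (2 * e) h →
                      PeriodicFrom i e (λ m → h (2 * m))
periodicFrom-double {e = e} {h} per m i≤m =
  trans (cong h (*-distribˡ-+ 2 m e)) (per (2 * m) (≤-trans i≤m (m≤m+n m (m + 0))))

solves-double : ∀ k {h} → Solves (suc k) h → Solves k (λ m → h (2 * m))
solves-double k {h} (accept-even , reject-odd) =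
  (λ j → trans (cong h (double-scale (2 * j) (2 ^ k))) (accept-even j)) ,
  (λ j → trans (cong h (double-scale (1 + 2 * j) (2 ^ k))) (reject-odd j))
  where
  double-scale : ∀ x p → 2 * (x * p) ≡ x * (2 * p)
  double-scale = solve-∀

solves⇒¬periodicFrom-odd : ∀ k {h i} e → Solves k h → ¬ PeriodicFrom i (1 + 2 * e) h
solves⇒¬periodicFrom-odd k {h} {i} e (accept-even , reject-odd) per =
  true≢false (begin
    true                           ≡⟨ accept-even i ⟨
    h m                            ≡⟨ periodicFrom-* per p m i≤m ⟨
    h (m + p * (1 + 2 * e))        ≡⟨ cong h (odd-shift i e p) ⟩
    h ((1 + 2 * (i + e)) * p)      ≡⟨ reject-odd (i + e) ⟩
    false                          ∎)
  where
  open ≡-Reasoning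
  p = 2 ^ k
  m = (2 * i) * p
  i≤m : i ≤ m
  i≤m = ≤-trans (m≤m+n i (i + 0)) (m≤m*n (2 * i) p {{m^n≢0 2 k}})
  odd-shift : ∀ i e p → (2 * i) * p + p * (1 + 2 * e) ≡ (1 + 2 * (i + e)) * p
  odd-shift = solve-∀
  true≢false : ¬ (true ≡ false)
  true≢false ()

solves⇒2^[1+k]∣period : ∀ k {h i d} → Solves k h → PeriodicFrom i d h → 2 ^ suc k ∣ d
solves⇒2^[1+k]∣period k {d = d} sol per with parityView d
... | odd e = ⊥-elim (solves⇒¬periodicFrom-odd k e sol per)
solves⇒2^[1+k]∣period zero    sol per | even e = m∣m*n e
solves⇒2^[1+k]∣period (suc k) {h} sol per | even e =
  *-monoʳ-∣ 2 (solves⇒2^[1+k]∣period k (solves-double k {h} sol)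
                                         (periodicFrom-double {e = e} {h} per))

iterate-+ : ∀ (f : A → A) x m n → iterate f x (m + n) ≡ iterate f (iterate f x m) n
iterate-+ f x zero    n = refl
iterate-+ f x (suc m) n = iterate-+ f (f x) m n

iterate-periodicFrom : ∀ (f : A → A) x {i d} → iterate f x i ≡ iterate f x (i + d) →
                       PeriodicFrom i d (iterate f x)
iterate-periodicFrom f x {i} {d} revisit m i≤m with m ∸ i | m+[n∸m]≡n i≤m
... | t | refl = begin
  iterate f x (i + t + d)           ≡⟨ cong (iterate f x) (swap-last i t d) ⟩
  iterate f x (i + d + t)           ≡⟨ iterate-+ f x (i + d) t ⟩
  iterate f (iterate f x (i + d)) t ≡⟨ cong (λ y → iterate f y t) revisit ⟨
  iterate f (iterate f x i) t       ≡⟨ iterate-+ f x i t ⟨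
  iterate f x (i + t)               ∎
  where
  open ≡-Reasoning
  swap-last : ∀ i t d → i + t + d ≡ i + d + t
  swap-last = solve-∀

orbit-revisits : ∀ {n} (f : Fin n → Fin n) x →
                 ∃₂ λ i d → 0 < d × d ≤ n × iterate f x i ≡ iterate f x (i + d)
orbit-revisits {n} f x with pigeonhole (n<1+n n) (λ j → iterate f x (toℕ j))
... | i , j , i<j , revisit =
  toℕ i , toℕ j ∸ toℕ i ,
  m<n⇒0<n∸m i<j ,
  ≤-trans (m∸n≤m (toℕ j) (toℕ i)) (toℕ≤pred[n] j) ,
  trans revisit (cong (iterate f x) (sym (m+[n∸m]≡n (<⇒≤ i<j))))

readA : ∀ {n} → DFA n → Fin n → Fin n
readA M q = δ M q a

run-aWord : ∀ {n} (M : DFA n) q m → run M q (aWord m) ≡ iterate (readA M) q m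
run-aWord M q zero    = refl
run-aWord M q (suc m) = run-aWord M (readA M q) m

accepts-aWord : ∀ {n} (M : DFA n) m →
  accepts M (aWord m) ≡ accept M (δ M (iterate (readA M) (δ M (start M) cent) m) dollar)
accepts-aWord M m = cong (accept M) (trans
  (foldl-++ (δ M) (δ M (start M) cent) (aWord m) (dollar ∷ []))
  (cong (λ q → δ M q dollar) (run-aWord M (δ M (start M) cent) m)))

accepts-aWord-periodicFrom : ∀ {n} (M : DFA n) → ∃₂ λ i d → 0 < d × d ≤ n ×
                             PeriodicFrom i d (λ m → accepts M (aWord m))
accepts-aWord-periodicFrom M with orbit-revisits (readA M) (δ M (start M) cent)
... | i , d , 0<d , d≤n , revisit = i , d , 0<d , d≤n , λ m i≤m → begin
  accepts M (aWord (m + d))                      ≡⟨ accepts-aWord M (m + d) ⟩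
  accept M (δ M (iterate (readA M) q₀ (m + d)) dollar)
    ≡⟨ cong (λ q → accept M (δ M q dollar)) (iterate-periodicFrom (readA M) q₀ revisit m i≤m) ⟩
  accept M (δ M (iterate (readA M) q₀ m) dollar) ≡⟨ accepts-aWord M m ⟨
  accepts M (aWord m)                            ∎
  where
  open ≡-Reasoning
  q₀ = δ M (start M) cent

solvesExactly⇒2^[1+k]≤states : ∀ k {n} (M : DFA n) → SolvesExactly k M → 2 ^ suc k ≤ n
solvesExactly⇒2^[1+k]≤states k M sol with accepts-aWord-periodicFrom M
... | i , d , 0<d , d≤n , per =
  ≤-trans (∣⇒≤ {{>-nonZero 0<d}} (solves⇒2^[1+k]∣period k sol per)) d≤n

[m%n+o]%n≡[m+o]%n : ∀ m o n .{{_ : NonZero n}} → (m % n + o) % n ≡ (m + o) % n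
[m%n+o]%n≡[m+o]%n m o n = begin
  (m % n + o) % n         ≡⟨ %-distribˡ-+ (m % n) o n ⟩
  (m % n % n + o % n) % n ≡⟨ cong (λ x → (x + o % n) % n) (m%n%n≡m%n m n) ⟩
  (m % n + o % n) % n     ≡⟨ %-distribˡ-+ m o n ⟨
  (m + o) % n             ∎
  where open ≡-Reasoning

module _ (N : ℕ) .{{_ : NonZero N}} where

  counter : DFA N
  counter = record
    { start  = 0 mod N
    ; δ      = λ { q a → suc (toℕ q) mod N ; q cent → q ; q dollar → q }
    ; accept = λ q → toℕ q ≡ᵇ 0
    }

  counter-iterate : ∀ q m → toℕ (iterate (readA counter) q m) ≡ (toℕ q + m) % N
  counter-iterate q zero = sym (trans (cong (_% N) (+-identityʳ (toℕ q))) (m<n⇒m%n≡m (toℕ<n q)))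
  counter-iterate q (suc m) = begin
    toℕ (iterate (readA counter) (suc (toℕ q) mod N) m) ≡⟨ counter-iterate (suc (toℕ q) mod N) m ⟩
    (toℕ (suc (toℕ q) mod N) + m) % N                   ≡⟨ cong (λ r → (r + m) % N) (toℕ-fromℕ< _) ⟩
    (suc (toℕ q) % N + m) % N                           ≡⟨ [m%n+o]%n≡[m+o]%n (suc (toℕ q)) m N ⟩
    (suc (toℕ q) + m) % N                               ≡⟨ cong (_% N) (+-suc (toℕ q) m) ⟨
    (toℕ q + suc m) % N                                 ∎
    where open ≡-Reasoning

  counter-accepts : ∀ m → accepts counter (aWord m) ≡ (m % N ≡ᵇ 0)
  counter-accepts m = trans (accepts-aWord counter m) (cong (_≡ᵇ 0) (trans
    (counter-iterate (0 mod N) m)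
    (trans (cong (λ r → (r + m) % N) (toℕ-fromℕ< _)) ([m%n+o]%n≡[m+o]%n 0 m N))))

module _ (p : ℕ) .{{_ : NonZero p}} where

  private instance
    2p≢0 : NonZero (2 * p)
    2p≢0 = m*n≢0 2 p

  [2j*p]%[2p]≡0 : ∀ j → (2 * j * p) % (2 * p) ≡ 0
  [2j*p]%[2p]≡0 j = trans (cong (_% (2 * p)) (rearrange j p)) (m*n%n≡0 j (2 * p))
    where
    rearrange : ∀ j p → 2 * j * p ≡ j * (2 * p)
    rearrange = solve-∀

  [[1+2j]*p]%[2p]≡p : ∀ j → ((1 + 2 * j) * p) % (2 * p) ≡ p
  [[1+2j]*p]%[2p]≡p j = begin
    ((1 + 2 * j) * p) % (2 * p) ≡⟨ cong (_% (2 * p)) (rearrange j p) ⟩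
    (p + j * (2 * p)) % (2 * p) ≡⟨ [m+kn]%n≡m%n p j (2 * p) ⟩
    p % (2 * p)                 ≡⟨ m<n⇒m%n≡m p<2p ⟩
    p                           ∎
    where
    open ≡-Reasoning
    rearrange : ∀ j p → (1 + 2 * j) * p ≡ p + j * (2 * p)
    rearrange = solve-∀
    p<2p : p < 2 * p
    p<2p = subst (p <_) (cong (p +_) (sym (+-identityʳ p))) (m<m+n p (>-nonZero⁻¹ p))

n>0⇒[n≡ᵇ0]≡false : ∀ {n} → 0 < n → (n ≡ᵇ 0) ≡ false
n>0⇒[n≡ᵇ0]≡false (s≤s _) = refl

counter-solvesExactly : ∀ k → SolvesExactly k (counter (2 ^ suc k) {{m^n≢0 2 (suc k)}})
counter-solvesExactly k =
  (λ j → trans (counter-accepts N (2 * j * p)) (cong (_≡ᵇ 0) ([2j*p]%[2p]≡0 p j))) ,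
  (λ j → trans (counter-accepts N ((1 + 2 * j) * p))
               (trans (cong (_≡ᵇ 0) ([[1+2j]*p]%[2p]≡p p j)) (n>0⇒[n≡ᵇ0]≡false (m^n>0 2 k))))
  where
  p = 2 ^ k
  N = 2 ^ suc k
  instance
    p≢0 : NonZero p
    p≢0 = m^n≢0 2 k
    N≢0 : NonZero N
    N≢0 = m^n≢0 2 (suc k)

mainTheorem3 : (k : ℕ) → 1 ≤ k →
    Σ (DFA (2 ^ suc k)) (λ M → SolvesExactly k M) ×
    ((n : ℕ) (M : DFA n) → SolvesExactly k M → 2 ^ suc k ≤ n)
mainTheorem3 k _ =
  (counter (2 ^ suc k) {{m^n≢0 2 (suc k)}} , counter-solvesExactly k) ,
  λ n M → solvesExactly⇒2^[1+k]≤states k M
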